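{- Let $0<\delta\le 1$ and let $G=(V,E)$ be a (multi)graph with $V=[n]$ and $E=\mathcal M_1\cup\cdots\cup\mathcal M_n$, where each $\mathcal M_i$ is a partial matching on $V$ of size at least $\delta n$ whose edges are labeled $i$. Let $S\subseteq V$ with $|R_G(S)|\le(1-\delta)n$. Then at least one of the following holds: (1) there exists $i\in V\setminus R_G(S)$ such that $|R_G(S\cup\{i\})|\ge |R_G(S)|+0.01\,\delta^2 n$; (2) in the graph $G'=(V',E')$ with $V'=V\setminus R_G(S)$ and $E'=\bigcup_{i\in V'}\big(\mathcal M_i\cap(V'\times V')\big)$, all but at most $0.1\delta|V'|$ of the matchings $\mathcal M_i\cap(V'\times V')$, $i\in V'$, have at least $0.9\delta n$ edges.
   Context: For $S\subseteq V$, $R_G(S)$ is the smallest set of vertices such that (1) $S\subseteq R_G(S)$, and (2) for all $i,j\in R_G(S)$ and all $k\in[n]$, if $(i,j)\in\mathcal M_k$ then $k\in R_G(S)$.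
   Formalization: The parameter δ takes rational values in (0,1]. -}

module Defs where

open import Data.Nat using (ℕ)
open import Data.Bool using (Bool; true; false; _∧_; not)
open import Data.Fin using (Fin)
open import Data.Fin.Subset using (Subset; _∈_; _∉_; _⊆_; ∣_∣; inside; outside)
open import Data.Vec using (lookup)
open import Data.Product using (_×_; _,_)
open import Data.List using (List; []; _∷_; concatMap; length; filterᵇ; allFin)
open import Data.List.Relation.Unary.Unique.Propositional using (Unique)
import Data.List.Membership.Propositional as L
open import Data.Integer using (+_)
open import Data.Rational using (ℚ; _/_; _≤ᵇ_)

ℕ→ℚ : ℕ → ℚ
ℕ→ℚ k = (+ k) / 1

-- an edge on vertex set [n] = Fin n, written as an (unordered) pair
Edge : ℕ → Set
Edge n = Fin n × Fin n

endpoints : ∀ {n} → List (Edge n) → List (Fin n)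
endpoints = concatMap (λ { (a , b) → a ∷ b ∷ [] })

-- a partial matching on Fin n: a list of edges in which no vertex occurs
-- twice among all endpoints (so no loops, no repeated edges, disjoint edges)
IsMatching : ∀ {n} → List (Edge n) → Set
IsMatching M = Unique (endpoints M)

Matchings : ℕ → Set
Matchings n = Fin n → List (Edge n)

Closed : ∀ {n} → Matchings n → Subset n → Set
Closed {n} M T = ∀ (k i j : Fin n) → i ∈ T → j ∈ T → (i , j) L.∈ M k → k ∈ T

-- R is R_G(S): the smallest closed set containing S
IsR : ∀ {n} → Matchings n → Subset n → Subset n → Set
IsR M S R = (S ⊆ R) × Closed M R × (∀ T → S ⊆ T → Closed M T → R ⊆ T)

isOut : ∀ {n} → Subset n → Fin n → Bool
isOut R i with lookup R i
... | inside = false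
... | outside = true

restrictedSize : ∀ {n} → Subset n → List (Edge n) → ℕ
restrictedSize R M = length (filterᵇ (λ { (a , b) → isOut R a ∧ isOut R b }) M)

numSmall : ∀ {n} → Matchings n → Subset n → ℚ → ℕ
numSmall {n} M R c =
  length (filterᵇ (λ i → isOut R i ∧ not (c ≤ᵇ ℕ→ℚ (restrictedSize R (M i)))) (allFin n))

-- Call a label k ∉ R small if M_k keeps fewer than c = 0.9δn edges inside V′ = V ∖ R.
-- Every other edge of M_k has an endpoint in R and so joins a vertex j to R; as R is
-- closed and k ∉ R, such a j lies in V′. A small matching has at least δn − c = 0.1δn
-- such edges, so if more than 0.1δ|V′| labels are small, counting the pairs (k, j) and
-- applying the pigeonhole principle over j ∈ V′ gives a j joined to R by the matchings
-- of at least 0.01δ²n small labels. Every closed set containing R and j contains all of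
-- these labels, none of which lies in R, so adding j to S grows R_G(S) by that much.
module Submission where

open import Defs
open import Data.Nat as ℕ using (ℕ; zero; suc; z≤n; s≤s; _∸_)
import Data.Nat.Properties as ℕₚ
open import Data.Nat.Coprimality as Coprime using ()
open import Data.Integer as ℤ using (+_)
import Data.Integer.Properties as ℤₚ
open import Data.Rational
  using (ℚ; _/_; _+_; _*_; _-_; -_; _≤_; _<_; 0ℚ; 1ℚ; _≤ᵇ_; mkℚ; toℚᵘ; *≤*; *<*; Positive; positive)
import Data.Rational.Properties as ℚₚ
import Data.Rational.Unnormalised as ℚᵘ
import Data.Rational.Unnormalised.Properties as ℚᵘₚ
open import Data.Rational.Solver using (module +-*-Solver)
open import Data.Bool using (Bool; true; false; _∧_; not; if_then_else_; T)
open import Data.Bool.Properties using (T-≡; T-∧; T-not-≡)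
open import Data.Fin using (Fin; _≟_) renaming (zero to fzero; suc to fsuc)
import Data.Fin.Properties as Finₚ
open import Data.Fin.Subset using (Subset; _∈_; _∉_; _⊆_; ∣_∣; ⁅_⁆; _∪_; inside; outside)
open import Data.Fin.Subset.Properties using (_∈?_; ∣p∣≤n; p⊆p∪q; q⊆p∪q; x∈⁅x⁆)
open import Data.Vec using (_∷_; []; here; there)
open import Data.List using (List; []; _∷_; length; filter; filterᵇ; tabulate; allFin)
open import Data.List.Membership.Propositional using () renaming (_∈_ to _∈ₗ_)
open import Data.List.Relation.Unary.All as All using (All; _∷_)
open import Data.List.Relation.Unary.AllPairs using (_∷_)
open import Data.List.Relation.Unary.Any using (here; there)
open import Data.Product using (Σ; ∃; _×_; _,_; proj₁; proj₂; map₂)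
open import Data.Sum using (_⊎_; inj₁; inj₂; [_,_]′)
open import Data.Empty using (⊥-elim)
open import Function using (_∘_; id)
open import Function.Bundles using (Equivalence)
open import Relation.Nullary using (yes; no; ¬_; does)
open import Relation.Nullary.Decidable using (T?; toSum; _×-dec_; _⊎-dec_; dec-true; dec-false)
open import Relation.Unary using (Pred; Decidable)
open import Relation.Binary.PropositionalEquality
open import Algebra.Properties.Semiring.Sum ℕₚ.+-*-semiring
  using (sum; sum-syntax; sum-cong-≗; sum-replicate-zero; ∑-comm; ∑-distrib-+; *-distribˡ-sum)
open import Algebra.Properties.CommutativeSemigroup ℕₚ.+-commutativeSemigroup
  using (interchange)

ℕ→ℚ≡mkℚ : ∀ k → ℕ→ℚ k ≡ mkℚ (+ k) 0 (Coprime.sym (Coprime.1-coprimeTo k))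
ℕ→ℚ≡mkℚ k = ℚₚ.normalize-coprime _

ℕ→ℚ-+ : ∀ a b → ℕ→ℚ (a ℕ.+ b) ≡ ℕ→ℚ a + ℕ→ℚ b
ℕ→ℚ-+ a b = ℚₚ.toℚᵘ-injective
  (ℚᵘₚ.≃-trans toℚᵘ-homo (ℚᵘₚ.≃-sym (ℚₚ.toℚᵘ-homo-+ (ℕ→ℚ a) (ℕ→ℚ b))))
  where
  toℚᵘ-homo : toℚᵘ (ℕ→ℚ (a ℕ.+ b)) ℚᵘ.≃ toℚᵘ (ℕ→ℚ a) ℚᵘ.+ toℚᵘ (ℕ→ℚ b)
  toℚᵘ-homo rewrite ℕ→ℚ≡mkℚ a | ℕ→ℚ≡mkℚ b | ℕ→ℚ≡mkℚ (a ℕ.+ b)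
                  | ℕₚ.*-identityʳ a | ℕₚ.*-identityʳ b | ℤₚ.+◃n≡+n a | ℤₚ.+◃n≡+n b
    = ℚᵘ.*≡* refl

ℕ→ℚ-mono-≤ : ∀ {a b} → a ℕ.≤ b → ℕ→ℚ a ≤ ℕ→ℚ b
ℕ→ℚ-mono-≤ {a} {b} a≤b rewrite ℕ→ℚ≡mkℚ a | ℕ→ℚ≡mkℚ b =
  *≤* (ℤₚ.*-monoʳ-≤-nonNeg (+ 1) (ℤ.+≤+ a≤b))

ℕ→ℚ-suc-pos : ∀ k → 0ℚ < ℕ→ℚ (suc k)
ℕ→ℚ-suc-pos k rewrite ℕ→ℚ≡mkℚ (suc k) = *<* (ℤ.+<+ (s≤s z≤n))

∑-mono-≤ : ∀ {n} {f g : Fin n → ℕ} → (∀ i → f i ℕ.≤ g i) → sum f ℕ.≤ sum g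
∑-mono-≤ {zero}  f≤g = z≤n
∑-mono-≤ {suc n} f≤g = ℕₚ.+-mono-≤ (f≤g fzero) (∑-mono-≤ (f≤g ∘ fsuc))

term-≤-∑ : ∀ {n} (f : Fin n → ℕ) i → f i ℕ.≤ sum f
term-≤-∑ f fzero    = ℕₚ.m≤m+n _ _
term-≤-∑ f (fsuc i) = ℕₚ.≤-trans (term-≤-∑ (f ∘ fsuc) i) (ℕₚ.m≤n+m _ _)

∑-scale-≤ : ∀ {n} (f g : Fin n → ℕ) (x : ℚ) →
  (∀ i → ℕ→ℚ (f i) * x ≤ ℕ→ℚ (g i)) → ℕ→ℚ (sum f) * x ≤ ℕ→ℚ (sum g)
∑-scale-≤ {zero}  f g x _ = ℚₚ.≤-reflexive (ℚₚ.*-zeroˡ x)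
∑-scale-≤ {suc n} f g x fx≤g = begin
  ℕ→ℚ (f fzero ℕ.+ sum (f ∘ fsuc)) * x          ≡⟨ cong (_* x) (ℕ→ℚ-+ (f fzero) _) ⟩
  (ℕ→ℚ (f fzero) + ℕ→ℚ (sum (f ∘ fsuc))) * x    ≡⟨ ℚₚ.*-distribʳ-+ x (ℕ→ℚ (f fzero)) _ ⟩
  ℕ→ℚ (f fzero) * x + ℕ→ℚ (sum (f ∘ fsuc)) * x  ≤⟨ ℚₚ.+-mono-≤ (fx≤g fzero)
                                                     (∑-scale-≤ (f ∘ fsuc) (g ∘ fsuc) x (fx≤g ∘ fsuc)) ⟩
  ℕ→ℚ (g fzero) + ℕ→ℚ (sum (g ∘ fsuc))          ≡⟨ ℕ→ℚ-+ (g fzero) _ ⟨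
  ℕ→ℚ (g fzero ℕ.+ sum (g ∘ fsuc))              ∎
  where open ℚₚ.≤-Reasoning

∑-≤-scale : ∀ {n} (f g : Fin n → ℕ) (x : ℚ) →
  (∀ i → ℕ→ℚ (f i) ≤ ℕ→ℚ (g i) * x) → ℕ→ℚ (sum f) ≤ ℕ→ℚ (sum g) * x
∑-≤-scale {zero}  f g x _ = ℚₚ.≤-reflexive (sym (ℚₚ.*-zeroˡ x))
∑-≤-scale {suc n} f g x f≤gx = begin
  ℕ→ℚ (f fzero ℕ.+ sum (f ∘ fsuc))              ≡⟨ ℕ→ℚ-+ (f fzero) _ ⟩
  ℕ→ℚ (f fzero) + ℕ→ℚ (sum (f ∘ fsuc))          ≤⟨ ℚₚ.+-mono-≤ (f≤gx fzero)
                                                     (∑-≤-scale (f ∘ fsuc) (g ∘ fsuc) x (f≤gx ∘ fsuc)) ⟩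
  ℕ→ℚ (g fzero) * x + ℕ→ℚ (sum (g ∘ fsuc)) * x  ≡⟨ ℚₚ.*-distribʳ-+ x (ℕ→ℚ (g fzero)) _ ⟨
  (ℕ→ℚ (g fzero) + ℕ→ℚ (sum (g ∘ fsuc))) * x    ≡⟨ cong (_* x) (ℕ→ℚ-+ (g fzero) _) ⟨
  ℕ→ℚ (g fzero ℕ.+ sum (g ∘ fsuc)) * x          ∎
  where open ℚₚ.≤-Reasoning

𝟙 : Bool → ℕ
𝟙 b = if b then 1 else 0

count : ∀ {n} → (Fin n → Bool) → ℕ
count {n} p = ∑[ i < n ] 𝟙 (p i)

𝟙≤1 : ∀ b → 𝟙 b ℕ.≤ 1
𝟙≤1 true  = s≤s z≤n
𝟙≤1 false = z≤n

𝟙-*-≤ : ∀ b m → 𝟙 b ℕ.* m ℕ.≤ m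
𝟙-*-≤ true  m = ℕₚ.≤-reflexive (ℕₚ.+-identityʳ m)
𝟙-*-≤ false m = z≤n

count-*-≤-∑ : ∀ {n} (p : Fin n → Bool) (f : Fin n → ℕ) (x : ℚ) →
  (∀ i → T (p i) → x ≤ ℕ→ℚ (f i)) → ℕ→ℚ (count p) * x ≤ ℕ→ℚ (∑[ i < n ] (𝟙 (p i) ℕ.* f i))
count-*-≤-∑ p f x x≤f = ∑-scale-≤ _ _ x (λ i → masked (p i) (x≤f i))
  where
  masked : ∀ b {m} → (T b → x ≤ ℕ→ℚ m) → ℕ→ℚ (𝟙 b) * x ≤ ℕ→ℚ (𝟙 b ℕ.* m)
  masked false _   = ℚₚ.≤-reflexive (ℚₚ.*-zeroˡ x)
  masked true {m} x≤m
    rewrite ℚₚ.*-identityˡ x | ℕₚ.+-identityʳ m = x≤m _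

pigeonhole : ∀ {n} (p : Fin n → Bool) (f : Fin n → ℕ) (x : ℚ) →
  ℕ→ℚ (count p) * x < ℕ→ℚ (∑[ i < n ] (𝟙 (p i) ℕ.* f i)) → ∃ λ i → T (p i) × x < ℕ→ℚ (f i)
pigeonhole p f x count*x<∑ with Finₚ.any? (λ i → T? (p i) ×-dec (x ℚₚ.<? ℕ→ℚ (f i)))
... | yes found = found
... | no none = ⊥-elim (ℚₚ.<-irrefl refl (ℚₚ.<-≤-trans count*x<∑
      (∑-≤-scale _ _ x (λ i → masked (p i) (λ pi → ℚₚ.≮⇒≥ (λ x<fi → none (i , pi , x<fi)))))))
  where
  masked : ∀ b {m} → (T b → ℕ→ℚ m ≤ x) → ℕ→ℚ (𝟙 b ℕ.* m) ≤ ℕ→ℚ (𝟙 b) * x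
  masked false _   = ℚₚ.≤-reflexive (sym (ℚₚ.*-zeroˡ x))
  masked true {m} m≤x
    rewrite ℚₚ.*-identityˡ x | ℕₚ.+-identityʳ m = m≤x _

length-filter-∷ : ∀ {a p} {A : Set a} {P : Pred A p} (P? : Decidable P) x xs →
  length (filter P? (x ∷ xs)) ≡ 𝟙 (does (P? x)) ℕ.+ length (filter P? xs)
length-filter-∷ P? x xs with does (P? x)
... | true  = refl
... | false = refl

length-filterᵇ-∷ : ∀ {a} {A : Set a} (p : A → Bool) x xs →
  length (filterᵇ p (x ∷ xs)) ≡ 𝟙 (p x) ℕ.+ length (filterᵇ p xs)
length-filterᵇ-∷ p = length-filter-∷ (T? ∘ p)

length-filterᵇ-tabulate : ∀ {a} {A : Set a} {n} (p : A → Bool) (f : Fin n → A) →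
  length (filterᵇ p (tabulate f)) ≡ ∑[ i < n ] 𝟙 (p (f i))
length-filterᵇ-tabulate {n = zero}  p f = refl
length-filterᵇ-tabulate {n = suc n} p f =
  trans (length-filterᵇ-∷ p (f fzero) _) (cong (𝟙 (p (f fzero)) ℕ.+_) (length-filterᵇ-tabulate p (f ∘ fsuc)))

length-filterᵇ-allFin : ∀ {n} (p : Fin n → Bool) → length (filterᵇ p (allFin n)) ≡ count p
length-filterᵇ-allFin p = length-filterᵇ-tabulate p id

filter-nonempty : ∀ {a p} {A : Set a} {P : Pred A p} (P? : Decidable P) xs →
  0 ℕ.< length (filter P? xs) → ∃ λ x → x ∈ₗ xs × P x
filter-nonempty P? (x ∷ xs) nonempty with P? x
... | yes px = x , here refl , px
... | no _   with filter-nonempty P? xs nonempty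
...   | y , y∈xs , py = y , there y∈xs , py

∈⇒isOut≡false : ∀ {n} {p : Subset n} {i} → i ∈ p → isOut p i ≡ false
∈⇒isOut≡false here      = refl
∈⇒isOut≡false (there i∈p) = ∈⇒isOut≡false i∈p

isOut≡false⇒∈ : ∀ {n} (p : Subset n) i → isOut p i ≡ false → i ∈ p
isOut≡false⇒∈ (inside ∷ p)  fzero    _   = here
isOut≡false⇒∈ (outside ∷ p) fzero    ()
isOut≡false⇒∈ (_ ∷ p)       (fsuc i) out = there (isOut≡false⇒∈ p i out)

isOut⇒∉ : ∀ {n} {p : Subset n} {i} → T (isOut p i) → i ∉ p
isOut⇒∉ out i∈p rewrite ∈⇒isOut≡false i∈p = out

∣p∣≡count : ∀ {n} (p : Subset n) → ∣ p ∣ ≡ count (not ∘ isOut p)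
∣p∣≡count []            = refl
∣p∣≡count (inside ∷ p)  = cong suc (∣p∣≡count p)
∣p∣≡count (outside ∷ p) = ∣p∣≡count p

n∸∣p∣≡count : ∀ {n} (p : Subset n) → n ∸ ∣ p ∣ ≡ count (isOut p)
n∸∣p∣≡count []            = refl
n∸∣p∣≡count (inside ∷ p)  = n∸∣p∣≡count p
n∸∣p∣≡count (outside ∷ p) = trans (ℕₚ.+-∸-assoc 1 (∣p∣≤n p)) (cong suc (n∸∣p∣≡count p))

𝟙-inside-mono : ∀ {n} {p q : Subset n} → p ⊆ q → ∀ i → 𝟙 (not (isOut p i)) ℕ.≤ 𝟙 (not (isOut q i))
𝟙-inside-mono {p = p} p⊆q i with isOut p i in out
... | true  = z≤n
... | false rewrite ∈⇒isOut≡false (p⊆q (isOut≡false⇒∈ p i out)) = s≤s z≤n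

JoinsTo : ∀ {n} → Subset n → Fin n → Edge n → Set
JoinsTo R j (a , b) = (a ≡ j × b ∈ R) ⊎ (b ≡ j × a ∈ R)

joinsTo? : ∀ {n} (R : Subset n) j → Decidable (JoinsTo R j)
joinsTo? R j (a , b) = (a ≟ j ×-dec b ∈? R) ⊎-dec (b ≟ j ×-dec a ∈? R)

crossings : ∀ {n} → Subset n → Fin n → List (Edge n) → ℕ
crossings R j E = length (filter (joinsTo? R j) E)

crossings-∷ : ∀ {n} (R : Subset n) j e (E : List (Edge n)) →
  crossings R j (e ∷ E) ≡ 𝟙 (does (joinsTo? R j e)) ℕ.+ crossings R j E
crossings-∷ R j = length-filter-∷ (joinsTo? R j)

crossings-∷-reject : ∀ {n} (R : Subset n) j e (E : List (Edge n)) →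
  ¬ JoinsTo R j e → crossings R j (e ∷ E) ≡ crossings R j E
crossings-∷-reject R j e E ¬joins =
  trans (crossings-∷ R j e E) (cong (λ d → 𝟙 d ℕ.+ crossings R j E) (dec-false (joinsTo? R j e) ¬joins))

crossings-∉endpoints : ∀ {n} (R : Subset n) j (E : List (Edge n)) →
  All (j ≢_) (endpoints E) → crossings R j E ≡ 0
crossings-∉endpoints R j []            _                 = refl
crossings-∉endpoints R j ((a , b) ∷ E) (j≢a ∷ j≢b ∷ j∉E) =
  trans (crossings-∷-reject R j (a , b) E ¬joins) (crossings-∉endpoints R j E j∉E)
  where
  ¬joins : ¬ JoinsTo R j (a , b)
  ¬joins (inj₁ (a≡j , _)) = j≢a (sym a≡j)
  ¬joins (inj₂ (b≡j , _)) = j≢b (sym b≡j)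

crossings-∷≤1 : ∀ {n} (R : Subset n) j e (E : List (Edge n)) →
  crossings R j E ≡ 0 → crossings R j (e ∷ E) ℕ.≤ 1
crossings-∷≤1 R j e E none = begin
  crossings R j (e ∷ E)                         ≡⟨ crossings-∷ R j e E ⟩
  𝟙 (does (joinsTo? R j e)) ℕ.+ crossings R j E ≡⟨ cong (𝟙 _ ℕ.+_) none ⟩
  𝟙 (does (joinsTo? R j e)) ℕ.+ 0               ≡⟨ ℕₚ.+-identityʳ _ ⟩
  𝟙 (does (joinsTo? R j e))                     ≤⟨ 𝟙≤1 _ ⟩
  1                                             ∎
  where open ℕₚ.≤-Reasoning

crossings≤1 : ∀ {n} (R : Subset n) j (E : List (Edge n)) → IsMatching E → crossings R j E ℕ.≤ 1
crossings≤1 R j []            _ = z≤n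
crossings≤1 R j ((a , b) ∷ E) (a∉ ∷ b∉ ∷ matching) with joinsTo? R j (a , b)
... | yes (inj₁ (refl , _)) = crossings-∷≤1 R a (a , b) E (crossings-∉endpoints R a E (All.tail a∉))
... | yes (inj₂ (refl , _)) = crossings-∷≤1 R b (a , b) E (crossings-∉endpoints R b E b∉)
... | no ¬joins = ℕₚ.≤-trans (ℕₚ.≤-reflexive (crossings-∷-reject R j (a , b) E ¬joins))
                             (crossings≤1 R j E matching)

restrictedSize-∷ : ∀ {n} (R : Subset n) a b E →
  restrictedSize R ((a , b) ∷ E) ≡ 𝟙 (isOut R a ∧ isOut R b) ℕ.+ restrictedSize R E
restrictedSize-∷ R a b E = length-filterᵇ-∷ _ (a , b) E

joining-edge-counted : ∀ {n} (R : Subset n) j e →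
  JoinsTo R j e → 1 ℕ.≤ ∑[ i < n ] 𝟙 (does (joinsTo? R i e))
joining-edge-counted R j e joins =
  ℕₚ.≤-trans (ℕₚ.≤-reflexive (cong 𝟙 (sym (dec-true (joinsTo? R j e) joins))))
             (term-≤-∑ (λ i → 𝟙 (does (joinsTo? R i e))) j)

edge-inside-or-joining : ∀ {n} (R : Subset n) a b →
  1 ℕ.≤ 𝟙 (isOut R a ∧ isOut R b) ℕ.+ ∑[ j < n ] 𝟙 (does (joinsTo? R j (a , b)))
edge-inside-or-joining R a b with isOut R a in outA | isOut R b in outB
... | true  | true  = s≤s z≤n
... | _     | false = ℕₚ.≤-trans (joining-edge-counted R a (a , b) (inj₁ (refl , isOut≡false⇒∈ R b outB)))
                                 (ℕₚ.m≤n+m _ _)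
... | false | true  = ℕₚ.≤-trans (joining-edge-counted R b (a , b) (inj₂ (refl , isOut≡false⇒∈ R a outA)))
                                 (ℕₚ.m≤n+m _ _)

length≤restrictedSize+crossings : ∀ {n} (R : Subset n) (E : List (Edge n)) →
  length E ℕ.≤ restrictedSize R E ℕ.+ ∑[ j < n ] crossings R j E
length≤restrictedSize+crossings R [] = z≤n
length≤restrictedSize+crossings {n} R ((a , b) ∷ E) = begin
  1 ℕ.+ length E
    ≤⟨ ℕₚ.+-mono-≤ (edge-inside-or-joining R a b) (length≤restrictedSize+crossings R E) ⟩
  (kept ℕ.+ ∑[ j < n ] joining j) ℕ.+ (restrictedSize R E ℕ.+ ∑[ j < n ] crossings R j E)
    ≡⟨ interchange kept _ _ _ ⟩
  (kept ℕ.+ restrictedSize R E) ℕ.+ (∑[ j < n ] joining j ℕ.+ ∑[ j < n ] crossings R j E)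
    ≡⟨ cong₂ ℕ._+_ (sym (restrictedSize-∷ R a b E)) (sym ∑-crossings-∷) ⟩
  restrictedSize R ((a , b) ∷ E) ℕ.+ ∑[ j < n ] crossings R j ((a , b) ∷ E)
    ∎
  where
  open ℕₚ.≤-Reasoning
  kept : ℕ
  kept = 𝟙 (isOut R a ∧ isOut R b)
  joining : Fin n → ℕ
  joining j = 𝟙 (does (joinsTo? R j (a , b)))
  ∑-crossings-∷ : ∑[ j < n ] crossings R j ((a , b) ∷ E) ≡ ∑[ j < n ] joining j ℕ.+ ∑[ j < n ] crossings R j E
  ∑-crossings-∷ = trans (sum-cong-≗ (λ j → crossings-∷ R j (a , b) E)) (∑-distrib-+ joining (λ j → crossings R j E))

joined-label∈ : ∀ {n} (M : Matchings n) {R T : Subset n} k j →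
  Closed M T → R ⊆ T → j ∈ T → 0 ℕ.< crossings R j (M k) → k ∈ T
joined-label∈ M {R} k j closed R⊆T j∈T nonempty with filter-nonempty (joinsTo? R j) (M k) nonempty
... | (a , b) , ab∈Mk , inj₁ (refl , b∈R) = closed k a b j∈T (R⊆T b∈R) ab∈Mk
... | (a , b) , ab∈Mk , inj₂ (refl , a∈R) = closed k a b (R⊆T a∈R) j∈T ab∈Mk

crossings≤𝟙∈ : ∀ {n} (M : Matchings n) {R T : Subset n} k j → IsMatching (M k) →
  Closed M T → R ⊆ T → j ∈ T → crossings R j (M k) ℕ.≤ 𝟙 (not (isOut T k))
crossings≤𝟙∈ M {R} k j matching closed R⊆T j∈T with 0 ℕ.<? crossings R j (M k)
... | yes nonempty rewrite ∈⇒isOut≡false (joined-label∈ M k j closed R⊆T j∈T nonempty) =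
  crossings≤1 R j (M k) matching
... | no empty = ℕₚ.≤-trans (ℕₚ.≮⇒≥ empty) z≤n

module _ {n} (M : Matchings n) (matching : ∀ k → IsMatching (M k)) (R : Subset n)
         (chosen : Fin n → Bool) (chosen⇒out : ∀ k → T (chosen k) → T (isOut R k)) where

  joinedLabels : Fin n → ℕ
  joinedLabels j = ∑[ k < n ] (𝟙 (chosen k) ℕ.* crossings R j (M k))

  ∑-joinedLabels : ∑[ j < n ] joinedLabels j ≡ ∑[ k < n ] (𝟙 (chosen k) ℕ.* ∑[ j < n ] crossings R j (M k))
  ∑-joinedLabels = trans (∑-comm (λ j k → 𝟙 (chosen k) ℕ.* crossings R j (M k)))
    (sum-cong-≗ (λ k → sym (*-distribˡ-sum (𝟙 (chosen k)) (λ j → crossings R j (M k)))))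

  chosen⇒isOut≡true : ∀ {k} → chosen k ≡ true → isOut R k ≡ true
  chosen⇒isOut≡true {k} isChosen = Equivalence.to T-≡ (chosen⇒out k (Equivalence.from T-≡ isChosen))

  joinedLabels-∈ : Closed M R → ∀ {j} → j ∈ R → joinedLabels j ≡ 0
  joinedLabels-∈ closed {j} j∈R = trans (sum-cong-≗ term≡0) (sum-replicate-zero n)
    where
    term≡0 : ∀ k → 𝟙 (chosen k) ℕ.* crossings R j (M k) ≡ 0
    term≡0 k with chosen k in isChosen
    ... | false = refl
    ... | true  = trans (ℕₚ.+-identityʳ _) (ℕₚ.n≤0⇒n≡0 (subst (λ o → crossings R j (M k) ℕ.≤ 𝟙 (not o))
                    (chosen⇒isOut≡true isChosen) (crossings≤𝟙∈ M k j (matching k) closed id j∈R)))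

  joinedLabels-masked : Closed M R → ∀ j → joinedLabels j ≡ 𝟙 (isOut R j) ℕ.* joinedLabels j
  joinedLabels-masked closed j with isOut R j in out
  ... | true  = sym (ℕₚ.+-identityʳ _)
  ... | false = joinedLabels-∈ closed (isOut≡false⇒∈ R j out)

  ∣R∣+joinedLabels≤∣R′∣ : ∀ {R′ j} → Closed M R′ → R ⊆ R′ → j ∈ R′ → ∣ R ∣ ℕ.+ joinedLabels j ℕ.≤ ∣ R′ ∣
  ∣R∣+joinedLabels≤∣R′∣ {R′} {j} closed′ R⊆R′ j∈R′ = begin
    ∣ R ∣ ℕ.+ joinedLabels j
      ≡⟨ cong (ℕ._+ joinedLabels j) (∣p∣≡count R) ⟩
    count (not ∘ isOut R) ℕ.+ joinedLabels j
      ≡⟨ ∑-distrib-+ (λ k → 𝟙 (not (isOut R k))) _ ⟨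
    ∑[ k < n ] (𝟙 (not (isOut R k)) ℕ.+ 𝟙 (chosen k) ℕ.* crossings R j (M k))
      ≤⟨ ∑-mono-≤ pointwise ⟩
    count (not ∘ isOut R′)
      ≡⟨ ∣p∣≡count R′ ⟨
    ∣ R′ ∣ ∎
    where
    open ℕₚ.≤-Reasoning
    pointwise : ∀ k → 𝟙 (not (isOut R k)) ℕ.+ 𝟙 (chosen k) ℕ.* crossings R j (M k) ℕ.≤ 𝟙 (not (isOut R′ k))
    pointwise k with chosen k in isChosen
    ... | false = ℕₚ.≤-trans (ℕₚ.≤-reflexive (ℕₚ.+-identityʳ _)) (𝟙-inside-mono R⊆R′ k)
    ... | true rewrite chosen⇒isOut≡true isChosen =
      ℕₚ.≤-trans (𝟙-*-≤ true _) (crossings≤𝟙∈ M k j (matching k) closed′ R⊆R′ j∈R′)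

  growth-by-joinedLabels : ∀ {S R′ j} x → IsR M S R → IsR M (S ∪ ⁅ j ⁆) R′ →
    x ≤ ℕ→ℚ (joinedLabels j) → ℕ→ℚ (∣ R ∣) + x ≤ ℕ→ℚ (∣ R′ ∣)
  growth-by-joinedLabels {S} {R′} {j} x (_ , _ , least) (S∪j⊆R′ , closed′ , _) x≤joined = begin
    ℕ→ℚ (∣ R ∣) + x                       ≤⟨ ℚₚ.+-monoʳ-≤ (ℕ→ℚ (∣ R ∣)) x≤joined ⟩
    ℕ→ℚ (∣ R ∣) + ℕ→ℚ (joinedLabels j)   ≡⟨ ℕ→ℚ-+ (∣ R ∣) _ ⟨
    ℕ→ℚ (∣ R ∣ ℕ.+ joinedLabels j)       ≤⟨ ℕ→ℚ-mono-≤ (∣R∣+joinedLabels≤∣R′∣ closed′ R⊆R′ j∈R′) ⟩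
    ℕ→ℚ (∣ R′ ∣)                          ∎
    where
    open ℚₚ.≤-Reasoning
    R⊆R′ : R ⊆ R′
    R⊆R′ = least R′ (S∪j⊆R′ ∘ p⊆p∪q ⁅ j ⁆) closed′
    j∈R′ : j ∈ R′
    j∈R′ = S∪j⊆R′ (q⊆p∪q S ⁅ j ⁆ (x∈⁅x⁆ j))

module _ {n} (M : Matchings n) (R : Subset n) (c : ℚ) where

  small : Fin n → Bool
  small k = isOut R k ∧ not (c ≤ᵇ ℕ→ℚ (restrictedSize R (M k)))

  numSmall≡count : numSmall M R c ≡ count small
  numSmall≡count = length-filterᵇ-allFin small

  small⇒out : ∀ k → T (small k) → T (isOut R k)
  small⇒out k = proj₁ ∘ Equivalence.to T-∧

  small⇒length-c≤crossings : ∀ k → T (small k) →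
    ℕ→ℚ (length (M k)) - c ≤ ℕ→ℚ (∑[ j < n ] crossings R j (M k))
  small⇒length-c≤crossings k isSmall = begin
    ℕ→ℚ (length (M k)) - c           ≤⟨ ℚₚ.+-monoˡ-≤ (- c) (ℕ→ℚ-mono-≤ (length≤restrictedSize+crossings R (M k))) ⟩
    ℕ→ℚ (kept ℕ.+ joining) - c       ≡⟨ cong (_- c) (ℕ→ℚ-+ kept joining) ⟩
    (ℕ→ℚ kept + ℕ→ℚ joining) - c     ≤⟨ ℚₚ.+-monoˡ-≤ (- c) (ℚₚ.+-monoˡ-≤ (ℕ→ℚ joining) kept≤c) ⟩
    (c + ℕ→ℚ joining) - c            ≡⟨ solve 2 (λ c x → (c :+ x) :- c := x) refl c (ℕ→ℚ joining) ⟩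
    ℕ→ℚ joining                      ∎
    where
    open ℚₚ.≤-Reasoning
    open +-*-Solver
    kept = restrictedSize R (M k)
    joining = ∑[ j < n ] crossings R j (M k)
    kept≤c : ℕ→ℚ kept ≤ c
    kept≤c = ℚₚ.<⇒≤ (ℚₚ.≰⇒> (λ c≤kept →
      subst T (Equivalence.to T-not-≡ (proj₂ (Equivalence.to T-∧ isSmall))) (ℚₚ.≤⇒≤ᵇ c≤kept)))

module _ (δ : ℚ) {n} (M : Matchings n) (matching : ∀ k → IsMatching (M k)) (R : Subset n) where

  private
    N c a t : ℚ
    N = ℕ→ℚ n
    c = ((+ 9) / 10) * δ * N
    a = ((+ 1) / 10) * δ * N
    t = ((+ 1) / 100) * δ * δ * N

  smallJoined : Fin n → ℕ
  smallJoined = joinedLabels M matching R (small M R c) (small⇒out M R c)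

  heavy-vertex : 0ℚ < δ → 0ℚ < N → (∀ k → δ * N ≤ ℕ→ℚ (length (M k))) → Closed M R →
    ((+ 1) / 10) * δ * ℕ→ℚ (n ∸ ∣ R ∣) < ℕ→ℚ (numSmall M R c) →
    ∃ λ j → T (isOut R j) × t < ℕ→ℚ (smallJoined j)
  heavy-vertex 0<δ 0<N large closed many = pigeonhole (isOut R) smallJoined t (begin-strict
    ℕ→ℚ (count (isOut R)) * t
      ≡⟨ cong (λ m → ℕ→ℚ m * t) (n∸∣p∣≡count R) ⟨
    ℕ→ℚ (n ∸ ∣ R ∣) * t
      ≡⟨ solve 3 (λ δ m N → m :* (con ((+ 1) / 100) :* δ :* δ :* N)
                     := (con ((+ 1) / 10) :* δ :* m) :* (con ((+ 1) / 10) :* δ :* N)) refl δ _ N ⟩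
    ((+ 1) / 10) * δ * ℕ→ℚ (n ∸ ∣ R ∣) * a
      <⟨ ℚₚ.*-monoˡ-<-pos a {{a-pos}} many ⟩
    ℕ→ℚ (numSmall M R c) * a
      ≡⟨ cong (λ m → ℕ→ℚ m * a) (numSmall≡count M R c) ⟩
    ℕ→ℚ (count (small M R c)) * a
      ≤⟨ count-*-≤-∑ (small M R c) _ a a≤crossings ⟩
    ℕ→ℚ (∑[ k < n ] (𝟙 (small M R c k) ℕ.* ∑[ j < n ] crossings R j (M k)))
      ≡⟨ cong ℕ→ℚ (∑-joinedLabels M matching R (small M R c) (small⇒out M R c)) ⟨
    ℕ→ℚ (∑[ j < n ] smallJoined j)
      ≡⟨ cong ℕ→ℚ (sum-cong-≗ (joinedLabels-masked M matching R (small M R c) (small⇒out M R c) closed)) ⟩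
    ℕ→ℚ (∑[ j < n ] (𝟙 (isOut R j) ℕ.* smallJoined j)) ∎)
    where
    open ℚₚ.≤-Reasoning
    open +-*-Solver
    a-pos : Positive a
    a-pos = ℚₚ.pos*pos⇒pos (((+ 1) / 10) * δ) {{ℚₚ.pos*pos⇒pos ((+ 1) / 10) δ {{positive 0<δ}}}} N {{positive 0<N}}
    a≤crossings : ∀ k → T (small M R c k) → a ≤ ℕ→ℚ (∑[ j < n ] crossings R j (M k))
    a≤crossings k isSmall = begin
      a                         ≡⟨ solve 2 (λ δ N → con ((+ 1) / 10) :* δ :* N
                                     := δ :* N :- con ((+ 9) / 10) :* δ :* N) refl δ N ⟩
      δ * N - c                 ≤⟨ ℚₚ.+-monoˡ-≤ (- c) (large k) ⟩
      ℕ→ℚ (length (M k)) - c   ≤⟨ small⇒length-c≤crossings M R c k isSmall ⟩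
      ℕ→ℚ (∑[ j < n ] crossings R j (M k)) ∎

  expanding-vertex : ∀ {S} → 0ℚ < δ → 0ℚ < ℕ→ℚ n → (∀ k → δ * ℕ→ℚ n ≤ ℕ→ℚ (length (M k))) → IsR M S R →
    ((+ 1) / 10) * δ * ℕ→ℚ (n ∸ ∣ R ∣) < ℕ→ℚ (numSmall M R (((+ 9) / 10) * δ * ℕ→ℚ n)) →
    Σ (Fin n) λ i → i ∉ R × (∀ (R′ : Subset n) → IsR M (S ∪ ⁅ i ⁆) R′ →
      ℕ→ℚ (∣ R ∣) + ((+ 1) / 100) * δ * δ * ℕ→ℚ n ≤ ℕ→ℚ (∣ R′ ∣))
  expanding-vertex 0<δ 0<N large isR@(_ , closed , _) many =
    map₂ (λ (out , heavy) → isOut⇒∉ out , λ R′ isR′ →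
            growth-by-joinedLabels M matching R (small M R c) (small⇒out M R c) t isR isR′ (ℚₚ.<⇒≤ heavy))
         (heavy-vertex 0<δ 0<N large closed many)

lemma3p10 : (δ : ℚ) → 0ℚ < δ → δ ≤ 1ℚ →
    (n : ℕ) → (M : Matchings n) →
    (∀ k → IsMatching (M k)) →
    (∀ k → δ * ℕ→ℚ n ≤ ℕ→ℚ (length (M k))) →
    (S R : Subset n) → IsR M S R →
    ℕ→ℚ (∣ R ∣) ≤ (1ℚ - δ) * ℕ→ℚ n →
    (Σ (Fin n) λ i → i ∉ R × (∀ (R′ : Subset n) → IsR M (S ∪ ⁅ i ⁆) R′ →
        ℕ→ℚ (∣ R ∣) + ((+ 1) / 100) * δ * δ * ℕ→ℚ n ≤ ℕ→ℚ (∣ R′ ∣)))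
    ⊎
    (ℕ→ℚ (numSmall M R (((+ 9) / 10) * δ * ℕ→ℚ n))
        ≤ ((+ 1) / 10) * δ * ℕ→ℚ (n ∸ ∣ R ∣))
lemma3p10 δ _ _ zero M _ _ S [] _ _ = inj₂ (ℚₚ.≤-reflexive (sym (ℚₚ.*-zeroʳ (((+ 1) / 10) * δ))))
lemma3p10 δ 0<δ _ n@(suc n-1) M matching large S R isR _ =
  [ inj₂ , inj₁ ∘ expanding-vertex δ M matching R 0<δ (ℕ→ℚ-suc-pos n-1) large isR ∘ ℚₚ.≰⇒> ]′
    (toSum (ℕ→ℚ (numSmall M R (((+ 9) / 10) * δ * ℕ→ℚ n)) ℚₚ.≤? ((+ 1) / 10) * δ * ℕ→ℚ (n ∸ ∣ R ∣)))
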